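{- Let $G$ be a connected graph with $n\ge9$ vertices. Then $G$ is $2$-metamour-regular if and only if $G$ is either $2$-regular or $(n-3)$-regular.
   Context: All graphs are finite and simple. A vertex $v$ is a metamour of $w$ in $G$ if their distance in $G$ is $2$; $G$ is $2$-metamour-regular if every vertex has exactly two metamours. -}

module Defs where

open import Data.Nat using (ℕ; zero; suc; _<_; _∸_)
open import Data.Fin using (Fin)
open import Data.Bool using (Bool; true; false)
open import Data.List using (List; length; filterᵇ)
open import Data.List using () renaming (allFin to allFinL)
open import Data.Product using (Σ; _×_; ∃; ∃-syntax)
open import Data.Sum using (_⊎_)
open import Relation.Binary.PropositionalEquality using (_≡_; _≢_)
open import Relation.Nullary using (¬_)

record Graph (n : ℕ) : Set where
  field
    adj     : Fin n → Fin n → Bool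
    sym     : ∀ v w → adj v w ≡ adj w v
    irrefl  : ∀ v → adj v v ≡ false

module _ {n : ℕ} (G : Graph n) where
  open Graph G

  Adj : Fin n → Fin n → Set
  Adj v w = adj v w ≡ true

  data Walk : Fin n → Fin n → ℕ → Set where
    nil  : ∀ v → Walk v v zero
    cons : ∀ {u v w k} → Adj u v → Walk v w k → Walk u w (suc k)

  Distance : Fin n → Fin n → ℕ → Set
  Distance v w d = Walk v w d × (∀ k → k < d → ¬ Walk v w k)

  Connected : Set
  Connected = ∀ v w → ∃[ k ] Walk v w k

  Metamour : Fin n → Fin n → Set
  Metamour v w = Distance v w 2

  TwoMetamourRegular : Set
  TwoMetamourRegular =
    ∀ v → ∃[ w₁ ] ∃[ w₂ ] (w₁ ≢ w₂ × Metamour v w₁ × Metamour v w₂ ×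
                            (∀ w → Metamour v w → w ≡ w₁ ⊎ w ≡ w₂))

  degree : Fin n → ℕ
  degree v = length (filterᵇ (adj v) (allFinL n))

  Regular : ℕ → Set
  Regular k = ∀ v → degree v ≡ k

module Submission where

-- If some vertex is within distance 2 of all others, then so are its neighbours and
-- its two metamours: otherwise the neighbourhood of that vertex would be covered by at
-- most five vertices, forcing n ≤ 8.  Every vertex then has exactly itself and its two
-- metamours as non-neighbours, so G is (n-3)-regular.  Otherwise every vertex x starts a
-- geodesic x–a–p–y with y at distance 3, and a case analysis of how two neighbours of x
-- other than a meet the neighbourhoods of a and p either yields three metamours of one
-- vertex or a set of at most eight vertices closed under adjacency, which connectivity
-- and n ≥ 9 rule out; so every degree is 2.  Conversely, a connected 2-regular graph on
-- n ≥ 9 vertices has neither triangles nor 4-cycles, and in an (n-3)-regular graph each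
-- vertex has two non-neighbours besides itself, each sharing a neighbour with it because
-- n-3 ≥ 6 neighbours do not fit among three non-neighbours.

open import Defs
open import Data.Nat using (ℕ; zero; suc; _+_; _∸_; _≤_; _<_; z≤n; s≤s)
open import Data.Nat.Properties
  using (+-suc; ≤-antisym; ≤-refl; ≤-trans; ≤⇒≯; m≤m+n; m+n∸n≡m; m∸n+n≡m; +-cancelˡ-≡; ∸-monoˡ-≤)
open import Data.Nat.Properties using (module ≤-Reasoning)
open import Data.Fin using (Fin; _≟_)
open import Data.Bool using (true)
open import Data.Bool.Properties using (T-≡) renaming (_≟_ to _≟ᵇ_)
open import Data.List using (List; []; _∷_; _++_; length; filter; filterᵇ; allFin)
open import Data.List.Properties using (length-++; length-tabulate)
open import Data.List.Membership.Propositional using (_∈_)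
open import Data.List.Membership.Propositional.Properties
  using (∈-∃++; ∈-++⁻; ∈-++⁺ˡ; ∈-++⁺ʳ; ∈-filter⁺; ∈-filter⁻; ∈-allFin)
open import Data.List.Relation.Binary.Subset.Propositional using (_⊆_)
open import Data.List.Relation.Unary.Any using (here; there)
open import Data.List.Relation.Unary.All as All using (All; []; _∷_)
open import Data.List.Relation.Unary.AllPairs using ([]; _∷_)
open import Data.List.Relation.Unary.Unique.Propositional using (Unique)
open import Data.List.Relation.Unary.Unique.Propositional.Properties using (allFin⁺; filter⁺)
open import Data.Product using (_×_; _,_; proj₁; proj₂; ∃-syntax)
open import Data.Sum using (_⊎_; inj₁; inj₂; [_,_])
open import Data.Empty using (⊥; ⊥-elim)
open import Data.Fin.Properties using (any?; all?; ¬∀⟶∃¬)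
open import Function using (_∘_)
open import Level using (_⊔_)
open import Function.Bundles using (_⇔_; mk⇔; Equivalence)
open import Function.Properties.Equivalence using () renaming (sym to ⇔-sym)
open import Relation.Nullary using (¬_; Dec; yes; no; contradiction)
open import Relation.Nullary.Decidable using (_×-dec_; _⊎-dec_; T?)
open import Relation.Unary using (Pred; Decidable)
open import Relation.Unary.Properties using (∁?)
open import Relation.Binary.PropositionalEquality using (_≡_; _≢_; refl; sym; trans; cong; subst; module ≡-Reasoning)

module _ {ℓ} {A : Set ℓ} where

  unique-⊆⇒length≤ : {xs ys : List A} → Unique xs → xs ⊆ ys → length xs ≤ length ys
  unique-⊆⇒length≤ {[]} _ _ = z≤n
  unique-⊆⇒length≤ {x ∷ xs} (x∉xs ∷ xs-unique) xs⊆ys with ∈-∃++ (xs⊆ys (here refl))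
  ... | us , vs , refl = begin
    suc (length xs)              ≤⟨ s≤s (unique-⊆⇒length≤ xs-unique xs⊆us++vs) ⟩
    suc (length (us ++ vs))      ≡⟨ cong suc (length-++ us) ⟩
    suc (length us + length vs)  ≡⟨ +-suc (length us) (length vs) ⟨
    length us + length (x ∷ vs)  ≡⟨ length-++ us ⟨
    length (us ++ x ∷ vs)        ∎
    where
    open ≤-Reasoning
    xs⊆us++vs : xs ⊆ us ++ vs
    xs⊆us++vs z∈xs with ∈-++⁻ us (xs⊆ys (there z∈xs))
    ... | inj₁ z∈us         = ∈-++⁺ˡ z∈us
    ... | inj₂ (here refl)  = ⊥-elim (All.lookup x∉xs z∈xs refl)
    ... | inj₂ (there z∈vs) = ∈-++⁺ʳ us z∈vs

  unique-⊆-⊇⇒length≡ : {xs ys : List A} → Unique xs → Unique ys → xs ⊆ ys → ys ⊆ xs →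
    length xs ≡ length ys
  unique-⊆-⊇⇒length≡ xs-unique ys-unique xs⊆ys ys⊆xs =
    ≤-antisym (unique-⊆⇒length≤ xs-unique xs⊆ys) (unique-⊆⇒length≤ ys-unique ys⊆xs)

  length-filter+length-filter-∁ : ∀ {p} {P : Pred A p} (P? : Decidable P) xs →
    length (filter P? xs) + length (filter (∁? P?) xs) ≡ length xs
  length-filter+length-filter-∁ P? [] = refl
  length-filter+length-filter-∁ P? (x ∷ xs) with P? x
  ... | yes _ = cong suc (length-filter+length-filter-∁ P? xs)
  ... | no _  = trans (+-suc _ _) (cong suc (length-filter+length-filter-∁ P? xs))

  ∈-from-≡⊎≡ : ∀ {z s s′ : A} {S} → z ≡ s ⊎ z ≡ s′ → s ∈ S → s′ ∈ S → z ∈ S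
  ∈-from-≡⊎≡ (inj₁ refl) s∈S _  = s∈S
  ∈-from-≡⊎≡ (inj₂ refl) _ s′∈S = s′∈S

  record ExactlyTwo {p} (P : Pred A p) : Set (ℓ ⊔ p) where
    constructor exactlyTwo
    field
      fst snd  : A
      fst≢snd  : fst ≢ snd
      P-fst    : P fst
      P-snd    : P snd
      P⇒fst⊎snd : ∀ {z} → P z → z ≡ fst ⊎ z ≡ snd

  module _ {p} {P : Pred A p} (two : ExactlyTwo P) where
    open ExactlyTwo two

    exactlyTwo-cases : ∀ {x y z} → P x → P y → x ≢ y → P z → z ≡ x ⊎ z ≡ y
    exactlyTwo-cases px py x≢y pz with P⇒fst⊎snd px | P⇒fst⊎snd py | P⇒fst⊎snd pz
    ... | inj₁ refl | inj₁ refl | _        = contradiction refl x≢y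
    ... | inj₂ refl | inj₂ refl | _        = contradiction refl x≢y
    ... | inj₁ refl | inj₂ refl | inj₁ z≡x = inj₁ z≡x
    ... | inj₁ refl | inj₂ refl | inj₂ z≡y = inj₂ z≡y
    ... | inj₂ refl | inj₁ refl | inj₁ z≡y = inj₂ z≡y
    ... | inj₂ refl | inj₁ refl | inj₂ z≡x = inj₁ z≡x

    exactlyTwo-¬three : ∀ {x y z} → P x → P y → P z → x ≢ y → x ≢ z → y ≢ z → ⊥
    exactlyTwo-¬three px py pz x≢y x≢z y≢z with exactlyTwo-cases px py x≢y pz
    ... | inj₁ refl = x≢z refl
    ... | inj₂ refl = y≢z refl

    exactlyTwo-another : ∀ {x} → P x → ∃[ y ] (P y × x ≢ y)
    exactlyTwo-another px with P⇒fst⊎snd px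
    ... | inj₁ refl = snd , P-snd , fst≢snd
    ... | inj₂ refl = fst , P-fst , fst≢snd ∘ sym

  exactlyTwo-⇔ : ∀ {p q} {P : Pred A p} {Q : Pred A q} → (∀ {z} → P z ⇔ Q z) → ExactlyTwo P → ExactlyTwo Q
  exactlyTwo-⇔ P⇔Q (exactlyTwo x y x≢y Px Py P⇒) =
    exactlyTwo x y x≢y (Equivalence.to P⇔Q Px) (Equivalence.to P⇔Q Py) (P⇒ ∘ Equivalence.from P⇔Q)

  exactlyTwo⇒length≡2 : ∀ {xs : List A} → Unique xs → ExactlyTwo (_∈ xs) → length xs ≡ 2
  exactlyTwo⇒length≡2 xs-unique (exactlyTwo a b a≢b a∈xs b∈xs ∈xs⇒) =
    unique-⊆-⊇⇒length≡ xs-unique ((a≢b ∷ []) ∷ [] ∷ []) xs⊆ab ab⊆xs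
    where
    xs⊆ab : _ ⊆ a ∷ b ∷ []
    xs⊆ab z∈xs with ∈xs⇒ z∈xs
    ... | inj₁ refl = here refl
    ... | inj₂ refl = there (here refl)
    ab⊆xs : a ∷ b ∷ [] ⊆ _
    ab⊆xs (here refl)         = a∈xs
    ab⊆xs (there (here refl)) = b∈xs

  length≡2⇒exactlyTwo : ∀ {xs : List A} → Unique xs → length xs ≡ 2 → ExactlyTwo (_∈ xs)
  length≡2⇒exactlyTwo {a ∷ b ∷ []} ((a≢b ∷ []) ∷ _) refl =
    exactlyTwo a b a≢b (here refl) (there (here refl)) λ where
      (here z≡a)         → inj₁ z≡a
      (there (here z≡b)) → inj₂ z≡b

  length≡3⇒exactlyTwo-≢ : ∀ {v} {xs : List A} → Unique xs → length xs ≡ 3 → v ∈ xs →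
    ExactlyTwo (λ z → z ∈ xs × z ≢ v)
  length≡3⇒exactlyTwo-≢ {xs = a ∷ b ∷ c ∷ []} ((a≢b ∷ a≢c ∷ []) ∷ (b≢c ∷ []) ∷ _) refl (here refl) =
    exactlyTwo b c b≢c (there (here refl) , a≢b ∘ sym) (there (there (here refl)) , a≢c ∘ sym) λ where
      (here refl , a≢a)              → contradiction refl a≢a
      (there (here z≡b) , _)         → inj₁ z≡b
      (there (there (here z≡c)) , _) → inj₂ z≡c
  length≡3⇒exactlyTwo-≢ {xs = a ∷ b ∷ c ∷ []} ((a≢b ∷ a≢c ∷ []) ∷ (b≢c ∷ []) ∷ _) refl (there (here refl)) =
    exactlyTwo a c a≢c (here refl , a≢b) (there (there (here refl)) , b≢c ∘ sym) λ where
      (here z≡a , _)                 → inj₁ z≡a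
      (there (here refl) , b≢b)      → contradiction refl b≢b
      (there (there (here z≡c)) , _) → inj₂ z≡c
  length≡3⇒exactlyTwo-≢ {xs = a ∷ b ∷ c ∷ []} ((a≢b ∷ a≢c ∷ []) ∷ (b≢c ∷ []) ∷ _) refl
                        (there (there (here refl))) =
    exactlyTwo a b a≢b (here refl , a≢c) (there (here refl) , b≢c) λ where
      (here z≡a , _)                 → inj₁ z≡a
      (there (here z≡b) , _)         → inj₂ z≡b
      (there (there (here refl)) , c≢c) → contradiction refl c≢c

allFin⊆⇒n≤length : ∀ {n} {zs : List (Fin n)} → (∀ z → z ∈ zs) → n ≤ length zs
allFin⊆⇒n≤length {n} {zs} complete =
  subst (_≤ length zs) (length-tabulate (λ i → i)) (unique-⊆⇒length≤ (allFin⁺ n) (λ {z} _ → complete z))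

module _ {n : ℕ} (G : Graph n) where
  open Graph G using (adj) renaming (sym to adj-sym; irrefl to adj-irrefl)

  infix 4 _~_ _≁_ _~₂_

  _~_ : Fin n → Fin n → Set
  _~_ = Adj G

  _≁_ : Fin n → Fin n → Set
  u ≁ v = ¬ u ~ v

  _~?_ : ∀ u v → Dec (u ~ v)
  u ~? v = adj u v ≟ᵇ true

  ~-sym : ∀ {u v} → u ~ v → v ~ u
  ~-sym {u} {v} u~v = trans (adj-sym v u) u~v

  ≁-sym : ∀ {u v} → u ≁ v → v ≁ u
  ≁-sym u≁v = u≁v ∘ ~-sym

  ~-irrefl : ∀ {v} → v ≁ v
  ~-irrefl {v} v~v with trans (sym v~v) (adj-irrefl v)
  ... | ()

  ~⇒≢ : ∀ {u v} → u ~ v → u ≢ v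
  ~⇒≢ u~u refl = ~-irrefl u~u

  ~-≁⇒≢ : ∀ {a u w} → a ~ u → a ≁ w → u ≢ w
  ~-≁⇒≢ a~u a≁u refl = a≁u a~u

  data _~₂_ (v w : Fin n) : Set where
    dist2 : ∀ {u} → w ≢ v → v ≁ w → v ~ u → u ~ w → v ~₂ w

  ~₂-sym : ∀ {v w} → v ~₂ w → w ~₂ v
  ~₂-sym (dist2 w≢v v≁w v~u u~w) = dist2 (w≢v ∘ sym) (≁-sym v≁w) (~-sym u~w) (~-sym v~u)

  ~₂⇒≢ : ∀ {v w} → v ~₂ w → w ≢ v
  ~₂⇒≢ (dist2 w≢v _ _ _) = w≢v

  ~₂⇒≁ : ∀ {v w} → v ~₂ w → v ≁ w
  ~₂⇒≁ (dist2 _ v≁w _ _) = v≁w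

  ~₂⇒Metamour : ∀ {v w} → v ~₂ w → Metamour G v w
  ~₂⇒Metamour {v} {w} (dist2 w≢v v≁w v~u u~w) = cons v~u (cons u~w (nil w)) , shorter
    where
    shorter : ∀ k → k < 2 → ¬ Walk G v w k
    shorter zero          _                (nil _)            = w≢v refl
    shorter (suc zero)    _                (cons v~w (nil _)) = v≁w v~w
    shorter (suc (suc _)) (s≤s (s≤s ()))

  Metamour⇒~₂ : ∀ {v w} → Metamour G v w → v ~₂ w
  Metamour⇒~₂ {v} {w} (cons v~u (cons u~w (nil _)) , shorter) =
    dist2 (λ { refl → shorter 0 (s≤s z≤n) (nil v) })
          (λ v~w → shorter 1 (s≤s (s≤s z≤n)) (cons v~w (nil w)))
          v~u u~w

  Neighbours NonNeighbours : Fin n → List (Fin n)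
  Neighbours v = filterᵇ (adj v) (allFin n)
  NonNeighbours v = filter (∁? (T? ∘ adj v)) (allFin n)

  Neighbours-unique : ∀ v → Unique (Neighbours v)
  Neighbours-unique v = filter⁺ (T? ∘ adj v) (allFin⁺ n)

  NonNeighbours-unique : ∀ v → Unique (NonNeighbours v)
  NonNeighbours-unique v = filter⁺ (∁? (T? ∘ adj v)) (allFin⁺ n)

  ∈-Neighbours : ∀ {v z} → z ∈ Neighbours v ⇔ v ~ z
  ∈-Neighbours = mk⇔ (Equivalence.to T-≡ ∘ proj₂ ∘ ∈-filter⁻ (T? ∘ adj _) {xs = allFin n})
                     (∈-filter⁺ (T? ∘ adj _) (∈-allFin _) ∘ Equivalence.from T-≡)

  ∈-NonNeighbours : ∀ {v z} → z ∈ NonNeighbours v ⇔ v ≁ z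
  ∈-NonNeighbours = mk⇔
    (λ z∈ v~z → proj₂ (∈-filter⁻ (∁? (T? ∘ adj _)) {xs = allFin n} z∈) (Equivalence.from T-≡ v~z))
    (λ v≁z → ∈-filter⁺ (∁? (T? ∘ adj _)) (∈-allFin _) (v≁z ∘ Equivalence.to T-≡))

  degree+nonNeighbours≡n : ∀ v → degree G v + length (NonNeighbours v) ≡ n
  degree+nonNeighbours≡n v =
    trans (length-filter+length-filter-∁ (T? ∘ adj v) (allFin n)) (length-tabulate (λ i → i))

  TwoMetamourRegular⇔exactlyTwo : TwoMetamourRegular G ⇔ (∀ v → ExactlyTwo (v ~₂_))
  TwoMetamourRegular⇔exactlyTwo = mk⇔ to from
    where
    to : TwoMetamourRegular G → ∀ v → ExactlyTwo (v ~₂_)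
    to tmr v with tmr v
    ... | w₁ , w₂ , w₁≢w₂ , w₁-metamour , w₂-metamour , only =
      exactlyTwo w₁ w₂ w₁≢w₂ (Metamour⇒~₂ w₁-metamour) (Metamour⇒~₂ w₂-metamour) (only _ ∘ ~₂⇒Metamour)
    from : (∀ v → ExactlyTwo (v ~₂_)) → TwoMetamourRegular G
    from two v = fst , snd , fst≢snd , ~₂⇒Metamour P-fst , ~₂⇒Metamour P-snd , λ _ → P⇒fst⊎snd ∘ Metamour⇒~₂
      where open ExactlyTwo (two v)

  Near : Fin n → Fin n → Set
  Near v t = t ≡ v ⊎ v ~ t ⊎ ∃[ u ] (v ~ u × u ~ t)

  Near? : ∀ v t → Dec (Near v t)
  Near? v t = (t ≟ v) ⊎-dec (v ~? t) ⊎-dec any? (λ u → (v ~? u) ×-dec (u ~? t))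

  Near-sym : ∀ {v w} → Near v w → Near w v
  Near-sym (inj₁ refl)                     = inj₁ refl
  Near-sym (inj₂ (inj₁ v~w))               = inj₂ (inj₁ (~-sym v~w))
  Near-sym (inj₂ (inj₂ (u , v~u , u~w)))   = inj₂ (inj₂ (u , ~-sym u~w , ~-sym v~u))

  record Far (v t : Fin n) : Set where
    field
      far-≢     : t ≢ v
      far-≁     : v ≁ t
      far-≁-nbr : ∀ {u} → v ~ u → u ≁ t
  open Far public

  ¬Near⇒Far : ∀ {v t} → ¬ Near v t → Far v t
  ¬Near⇒Far ¬near = record
    { far-≢     = ¬near ∘ inj₁
    ; far-≁     = ¬near ∘ inj₂ ∘ inj₁
    ; far-≁-nbr = λ v~u u~t → ¬near (inj₂ (inj₂ (_ , v~u , u~t)))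
    }

  Far⇒¬Near : ∀ {v t} → Far v t → ¬ Near v t
  Far⇒¬Near far (inj₁ t≡v)                    = far-≢ far t≡v
  Far⇒¬Near far (inj₂ (inj₁ v~t))             = far-≁ far v~t
  Far⇒¬Near far (inj₂ (inj₂ (_ , v~u , u~t))) = far-≁-nbr far v~u u~t

  Closed : List (Fin n) → Set
  Closed S = All (λ s → ∀ {z} → s ~ z → z ∈ S) S

  walk-stays-in-closed : ∀ {S} → Closed S → ∀ {u w k} → Walk G u w k → u ∈ S → w ∈ S
  walk-stays-in-closed closed (nil _)         u∈S = u∈S
  walk-stays-in-closed closed (cons u~v walk) u∈S = walk-stays-in-closed closed walk (All.lookup closed u∈S u~v)

  record Geodesic (x a p y : Fin n) : Set where
    constructor geodesic
    field
      x~a   : x ~ a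
      a~p   : a ~ p
      p~y   : p ~ y
      far-y : Far x y

  geodesic⇒~₂ : ∀ {x a p y} → Geodesic x a p y → x ~₂ p
  geodesic⇒~₂ (geodesic x~a a~p p~y far-y) =
    dist2 (λ { refl → far-≁ far-y p~y }) (λ x~p → far-≁-nbr far-y x~p p~y) x~a a~p

  boundary-edge : ∀ {v s t k} → Walk G s t k → Near v s → ¬ Near v t →
    ∃[ s′ ] ∃[ t′ ] (Near v s′ × s′ ~ t′ × ¬ Near v t′)
  boundary-edge (nil _) near ¬near = contradiction near ¬near
  boundary-edge {v} (cons {v = s₁} s~s₁ walk) near ¬near with Near? v s₁
  ... | yes near₁ = boundary-edge walk near₁ ¬near
  ... | no ¬near₁ = _ , s₁ , near , s~s₁ , ¬near₁

  module _ (connected : Connected G) where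

    closed⇒n≤length : ∀ {S x} → Closed S → x ∈ S → n ≤ length S
    closed⇒n≤length {x = x} closed x∈S =
      allFin⊆⇒n≤length (λ w → walk-stays-in-closed closed (proj₂ (connected x w)) x∈S)

    ¬closed-≤8 : 9 ≤ n → ∀ {S x} → Closed S → x ∈ S → ¬ length S ≤ 8
    ¬closed-≤8 9≤n closed x∈S len≤8 = ≤⇒≯ 9≤n (s≤s (≤-trans (closed⇒n≤length closed x∈S) len≤8))

    far⇒geodesic : ∀ {v t} → Far v t → ∃[ a ] ∃[ p ] ∃[ y ] Geodesic v a p y
    far⇒geodesic {v} {t} far with boundary-edge (proj₂ (connected v t)) (inj₁ refl) (Far⇒¬Near far)
    ... | _ , _ , inj₁ refl , v~y , ¬near =
      contradiction (inj₂ (inj₁ v~y)) ¬near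
    ... | s , _ , inj₂ (inj₁ v~s) , s~y , ¬near =
      contradiction (inj₂ (inj₂ (s , v~s , s~y))) ¬near
    ... | p , y , inj₂ (inj₂ (a , v~a , a~p)) , p~y , ¬near =
      a , p , y , geodesic v~a a~p p~y (¬Near⇒Far ¬near)

  module MetamourRegular (tmr : TwoMetamourRegular G) where

    metamours : ∀ v → ExactlyTwo (v ~₂_)
    metamours = Equivalence.to TwoMetamourRegular⇔exactlyTwo tmr

    ~₂-cases : ∀ {v a b c} → v ~₂ a → v ~₂ b → a ≢ b → v ~₂ c → c ≡ a ⊎ c ≡ b
    ~₂-cases {v} = exactlyTwo-cases (metamours v)

    ¬three-~₂ : ∀ {v a b c} → v ~₂ a → v ~₂ b → v ~₂ c → a ≢ b → a ≢ c → b ≢ c → ⊥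
    ¬three-~₂ {v} = exactlyTwo-¬three (metamours v)

    another-~₂ : ∀ {v a} → v ~₂ a → ∃[ b ] (v ~₂ b × a ≢ b)
    another-~₂ {v} = exactlyTwo-another (metamours v)

    ~₂-other : ∀ {v a b c} → v ~₂ a → v ~₂ b → a ≢ b → v ~₂ c → c ≢ a → c ≡ b
    ~₂-other v~₂a v~₂b a≢b v~₂c c≢a with ~₂-cases v~₂a v~₂b a≢b v~₂c
    ... | inj₁ c≡a = contradiction c≡a c≢a
    ... | inj₂ c≡b = c≡b

    degree-centre : ∀ {v} → (∀ t → Near v t) → degree G v ≡ n ∸ 3
    degree-centre {v} centre = begin
      degree G v                                  ≡⟨ m+n∸n≡m (degree G v) 3 ⟨
      degree G v + 3 ∸ 3                          ≡⟨ cong (λ k → degree G v + k ∸ 3) nonNeighbours≡3 ⟨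
      degree G v + length (NonNeighbours v) ∸ 3   ≡⟨ cong (_∸ 3) (degree+nonNeighbours≡n v) ⟩
      n ∸ 3                                       ∎
      where
      open ≡-Reasoning
      open ExactlyTwo (metamours v)
      triple-unique : Unique (v ∷ fst ∷ snd ∷ [])
      triple-unique = ((~₂⇒≢ P-fst ∘ sym) ∷ (~₂⇒≢ P-snd ∘ sym) ∷ []) ∷ (fst≢snd ∷ []) ∷ [] ∷ []
      nonNeighbours⊆ : NonNeighbours v ⊆ v ∷ fst ∷ snd ∷ []
      nonNeighbours⊆ {z} z∈ with centre z | Equivalence.to ∈-NonNeighbours z∈
      ... | inj₁ refl                   | _   = here refl
      ... | inj₂ (inj₁ v~z)             | v≁z = contradiction v~z v≁z
      ... | inj₂ (inj₂ (_ , v~u , u~z)) | v≁z with z ≟ v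
      ...   | yes refl = here refl
      ...   | no z≢v with P⇒fst⊎snd (dist2 z≢v v≁z v~u u~z)
      ...     | inj₁ refl = there (here refl)
      ...     | inj₂ refl = there (there (here refl))
      ⊆nonNeighbours : v ∷ fst ∷ snd ∷ [] ⊆ NonNeighbours v
      ⊆nonNeighbours (here refl)                 = Equivalence.from ∈-NonNeighbours ~-irrefl
      ⊆nonNeighbours (there (here refl))         = Equivalence.from ∈-NonNeighbours (~₂⇒≁ P-fst)
      ⊆nonNeighbours (there (there (here refl))) = Equivalence.from ∈-NonNeighbours (~₂⇒≁ P-snd)
      nonNeighbours≡3 : length (NonNeighbours v) ≡ 3
      nonNeighbours≡3 =
        unique-⊆-⊇⇒length≡ (NonNeighbours-unique v) triple-unique nonNeighbours⊆ ⊆nonNeighbours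

    m₁ m₂ : Fin n → Fin n
    m₁ v = ExactlyTwo.fst (metamours v)
    m₂ v = ExactlyTwo.snd (metamours v)

    ~₂⇒m₁⊎m₂ : ∀ {v w} → v ~₂ w → w ≡ m₁ v ⊎ w ≡ m₂ v
    ~₂⇒m₁⊎m₂ {v} = ExactlyTwo.P⇒fst⊎snd (metamours v)

    module Centre (9≤n : 9 ≤ n) {x} (centre : ∀ t → Near x t) where
      open ExactlyTwo (metamours x) using ()
        renaming (fst to p; snd to q; P-fst to x~₂p; P-snd to x~₂q; P⇒fst⊎snd to x-metamour)

      n≰8 : ¬ n ≤ 8
      n≰8 n≤8 = ≤⇒≯ 9≤n (s≤s n≤8)

      vertex-cases : ∀ z → z ≡ x ⊎ x ~ z ⊎ z ≡ p ⊎ z ≡ q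
      vertex-cases z with centre z
      ... | inj₁ z≡x                    = inj₁ z≡x
      ... | inj₂ (inj₁ x~z)             = inj₂ (inj₁ x~z)
      ... | inj₂ (inj₂ (_ , x~u , u~z)) with x ~? z | z ≟ x
      ...   | yes x~z | _        = inj₂ (inj₁ x~z)
      ...   | no _    | yes z≡x  = inj₁ z≡x
      ...   | no x≁z  | no z≢x   = inj₂ (inj₂ (x-metamour (dist2 z≢x x≁z x~u u~z)))

      neighbours⊆⇒n≤3+length : ∀ L → (∀ {z} → x ~ z → z ∈ L) → n ≤ 3 + length L
      neighbours⊆⇒n≤3+length L nbr∈L = allFin⊆⇒n≤length covered
        where
        covered : ∀ z → z ∈ x ∷ p ∷ q ∷ L
        covered z with vertex-cases z
        ... | inj₁ refl               = here refl
        ... | inj₂ (inj₁ x~z)         = there (there (there (nbr∈L x~z)))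
        ... | inj₂ (inj₂ (inj₁ refl)) = there (here refl)
        ... | inj₂ (inj₂ (inj₂ refl)) = there (there (here refl))

      neighbour-near-metamour : ∀ {v w} → x ~₂ w → x ~ v → Near v w
      neighbour-near-metamour {v} {w} x~₂w@(dist2 {a} _ x≁w x~a a~w) x~v with Near? v w
      ... | yes near = near
      ... | no ¬near with another-~₂ (~₂-sym x~₂w)
      ...   | w′ , w~₂w′ , x≢w′ =
        ⊥-elim (n≰8 (neighbours⊆⇒n≤3+length (m₁ v ∷ m₂ v ∷ m₁ a ∷ m₂ a ∷ w′ ∷ []) nbr∈L))
        where
        far = ¬Near⇒Far ¬near
        nbr∈L : ∀ {z} → x ~ z → z ∈ m₁ v ∷ m₂ v ∷ m₁ a ∷ m₂ a ∷ w′ ∷ []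
        nbr∈L {z} x~z with w ~? z | a ~? z
        ... | yes w~z | _ with ~₂⇒m₁⊎m₂ (dist2 (~-≁⇒≢ w~z (≁-sym (far-≁ far)))
                                              (λ v~z → far-≁-nbr far v~z (~-sym w~z)) (~-sym x~v) x~z)
        ...   | inj₁ refl = here refl
        ...   | inj₂ refl = there (here refl)
        nbr∈L {z} x~z | no w≁z | yes a~z =
          there (there (there (there (here (~₂-other (~₂-sym x~₂w) w~₂w′ x≢w′
            (dist2 (~-≁⇒≢ x~z x≁w) w≁z (~-sym a~w) a~z) (~⇒≢ x~z ∘ sym))))))
        nbr∈L {z} x~z | no w≁z | no a≁z
          with ~₂⇒m₁⊎m₂ (dist2 (λ { refl → w≁z (~-sym a~w) }) a≁z (~-sym x~a) x~z)
        ...   | inj₁ refl = there (there (here refl))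
        ...   | inj₂ refl = there (there (there (here refl)))

      metamours-near : Near p q
      metamours-near with Near? p q
      ... | yes near = near
      ... | no ¬near with another-~₂ (~₂-sym x~₂p) | another-~₂ (~₂-sym x~₂q)
      ...   | p′ , p~₂p′ , x≢p′ | q′ , q~₂q′ , x≢q′ =
        ⊥-elim (n≰8 (≤-trans (neighbours⊆⇒n≤3+length (p′ ∷ q′ ∷ []) nbr∈L) (m≤m+n 5 3)))
        where
        far = ¬Near⇒Far ¬near
        nbr∈L : ∀ {z} → x ~ z → z ∈ p′ ∷ q′ ∷ []
        nbr∈L {z} x~z with p ~? z | neighbour-near-metamour x~₂p x~z | neighbour-near-metamour x~₂q x~z
        ... | no p≁z  | inj₁ refl                   | _ = contradiction x~z (~₂⇒≁ x~₂p)
        ... | no p≁z  | inj₂ (inj₁ z~p)             | _ = contradiction (~-sym z~p) p≁z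
        ... | no p≁z  | inj₂ (inj₂ (_ , z~u , u~p)) | _ =
          here (~₂-other (~₂-sym x~₂p) p~₂p′ x≢p′
                  (dist2 (~-≁⇒≢ x~z (~₂⇒≁ x~₂p)) p≁z (~-sym u~p) (~-sym z~u)) (~⇒≢ x~z ∘ sym))
        ... | yes p~z | _ | inj₁ refl                   = contradiction x~z (~₂⇒≁ x~₂q)
        ... | yes p~z | _ | inj₂ (inj₁ z~q)             = contradiction z~q (far-≁-nbr far p~z)
        ... | yes p~z | _ | inj₂ (inj₂ (_ , z~u , u~q)) =
          there (here (~₂-other (~₂-sym x~₂q) q~₂q′ x≢q′
                  (dist2 (~-≁⇒≢ x~z (~₂⇒≁ x~₂q)) (≁-sym (far-≁-nbr far p~z)) (~-sym u~q) (~-sym z~u))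
                  (~⇒≢ x~z ∘ sym)))

      centre-everywhere : ∀ v t → Near v t
      centre-everywhere v t with vertex-cases v | vertex-cases t
      ... | inj₁ refl               | _                       = centre t
      ... | _                       | inj₁ refl               = Near-sym (centre v)
      ... | inj₂ (inj₁ x~v)         | inj₂ (inj₁ x~t)         = inj₂ (inj₂ (x , ~-sym x~v , x~t))
      ... | inj₂ (inj₁ x~v)         | inj₂ (inj₂ (inj₁ refl)) = neighbour-near-metamour x~₂p x~v
      ... | inj₂ (inj₁ x~v)         | inj₂ (inj₂ (inj₂ refl)) = neighbour-near-metamour x~₂q x~v
      ... | inj₂ (inj₂ (inj₁ refl)) | inj₂ (inj₁ x~t)         = Near-sym (neighbour-near-metamour x~₂p x~t)
      ... | inj₂ (inj₂ (inj₂ refl)) | inj₂ (inj₁ x~t)         = Near-sym (neighbour-near-metamour x~₂q x~t)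
      ... | inj₂ (inj₂ (inj₁ refl)) | inj₂ (inj₂ (inj₁ refl)) = inj₁ refl
      ... | inj₂ (inj₂ (inj₁ refl)) | inj₂ (inj₂ (inj₂ refl)) = metamours-near
      ... | inj₂ (inj₂ (inj₂ refl)) | inj₂ (inj₂ (inj₁ refl)) = Near-sym metamours-near
      ... | inj₂ (inj₂ (inj₂ refl)) | inj₂ (inj₂ (inj₂ refl)) = inj₁ refl

    module NoCentre (connected : Connected G) (9≤n : 9 ≤ n) (far-vertex : ∀ v → ∃[ t ] Far v t) where

      geodesic-from : ∀ v → ∃[ a ] ∃[ p ] ∃[ y ] Geodesic v a p y
      geodesic-from v = far⇒geodesic connected (proj₂ (far-vertex v))

      ∈-by-~₂ : ∀ {h m m′ z S} → h ~₂ m → h ~₂ m′ → m ≢ m′ → m ∈ S → m′ ∈ S → h ~₂ z → z ∈ S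
      ∈-by-~₂ h~₂m h~₂m′ m≢m′ m∈S m′∈S h~₂z = ∈-from-≡⊎≡ (~₂-cases h~₂m h~₂m′ m≢m′ h~₂z) m∈S m′∈S

      ∈-by-two-steps : ∀ {h s z S} → h ~ s → s ~ z → h ∈ S → (h ~ z → z ∈ S) → (h ~₂ z → z ∈ S) → z ∈ S
      ∈-by-two-steps {h} {z = z} h~s s~z h∈S near∈S far∈S with h ~? z | z ≟ h
      ... | yes h~z | _        = near∈S h~z
      ... | no _    | yes refl = h∈S
      ... | no h≁z  | no z≢h   = far∈S (dist2 z≢h h≁z h~s s~z)

      -- In the names below, Nₐ and Nₚ are the neighbourhoods of a and p, and in a module
      -- Via-v the vertex t is far from a and reached along a geodesic a – _ – v – t.
      module Around {x a p y} (g : Geodesic x a p y) where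
        open Geodesic g

        x~₂p : x ~₂ p
        x~₂p = geodesic⇒~₂ g

        p~₂x : p ~₂ x
        p~₂x = ~₂-sym x~₂p

        nbr≁y : ∀ {b} → x ~ b → b ≁ y
        nbr≁y = far-≁-nbr far-y

        nbr≢y : ∀ {b} → x ~ b → b ≢ y
        nbr≢y x~b = ~-≁⇒≢ x~b (far-≁ far-y)

        nbr≢p : ∀ {b} → x ~ b → b ≢ p
        nbr≢p x~b = ~-≁⇒≢ x~b (~₂⇒≁ x~₂p)

        a~₂y : a ~₂ y
        a~₂y = dist2 (nbr≢y x~a ∘ sym) (nbr≁y x~a) a~p p~y

        y~₂a : y ~₂ a
        y~₂a = ~₂-sym a~₂y

        a~₂nbr : ∀ {c} → x ~ c → c ≢ a → a ≁ c → a ~₂ c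
        a~₂nbr x~c c≢a a≁c = dist2 c≢a a≁c (~-sym x~a) x~c

        p~₂nbr : ∀ {b} → x ~ b → a ~ b → p ≁ b → p ~₂ b
        p~₂nbr x~b a~b p≁b = dist2 (nbr≢p x~b) p≁b (~-sym a~p) a~b

        y~₂nbr : ∀ {b} → x ~ b → p ~ b → y ~₂ b
        y~₂nbr x~b p~b = dist2 (nbr≢y x~b) (≁-sym (nbr≁y x~b)) (~-sym p~y) p~b

        far-from-a⇒p~₂ : ∀ {w t} → p ~ w → w ~ t → Far a t → p ~₂ t
        far-from-a⇒p~₂ p~w w~t far-t = dist2 (~-≁⇒≢ a~p (far-≁ far-t) ∘ sym) (far-≁-nbr far-t a~p) p~w w~t

        ¬far-from-a-near-p : ∀ {b w t} → x ~ b → a ~ b → p ~₂ b → p ~ w → w ~ t → ¬ Far a t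
        ¬far-from-a-near-p x~b a~b p~₂b p~w w~t far-t
          with ~₂-cases p~₂x p~₂b (~⇒≢ x~b) (far-from-a⇒p~₂ p~w w~t far-t)
        ... | inj₁ refl = far-≁ far-t (~-sym x~a)
        ... | inj₂ refl = far-≁ far-t a~b

        module OutsideNₐ-InNₐ∖Nₚ {b c} (x~b : x ~ b) (x~c : x ~ c) (c≢a : c ≢ a) (a≁c : a ≁ c)
                                  (a~b : a ~ b) (p≁b : p ≁ b) where

          a~₂c : a ~₂ c
          a~₂c = a~₂nbr x~c c≢a a≁c

          p~₂b : p ~₂ b
          p~₂b = p~₂nbr x~b a~b p≁b

          y≢c : y ≢ c
          y≢c = nbr≢y x~c ∘ sym

          c~₂a : c ~₂ a
          c~₂a = ~₂-sym a~₂c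

          x~₂-beyond-c : ∀ {t} → c ~ t → Far a t → x ~₂ t
          x~₂-beyond-c c~t far-t =
            dist2 (λ { refl → far-≁ far-t (~-sym x~a) }) (far-≁-nbr far-t (~-sym x~a)) x~c c~t

          module Via-c-with-p≁c {t M} (p≁c : p ≁ c) (c~t : c ~ t) (far-t : Far a t)
                                      (y~₂M : y ~₂ M) (a≢M : a ≢ M) where

            x~₂t : x ~₂ t
            x~₂t = x~₂-beyond-c c~t far-t

            p≢t : p ≢ t
            p≢t = ~-≁⇒≢ a~p (far-≁ far-t)

            y-nbr≡p : ∀ {z} → y ~ z → z ≡ p
            y-nbr≡p {z} y~z with z ≟ p | a ~? z | p ~? z
            ... | yes z≡p | _       | _ = z≡p
            ... | no z≢p  | yes a~z | _
              with ~₂-cases x~₂p x~₂t p≢t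
                     (dist2 (~-≁⇒≢ y~z (≁-sym (far-≁ far-y))) (λ x~z → nbr≁y x~z (~-sym y~z)) x~a a~z)
            ...   | inj₁ z≡p = contradiction z≡p z≢p
            ...   | inj₂ refl = contradiction a~z (far-≁ far-t)
            y-nbr≡p {z} y~z | no z≢p | no a≁z | yes p~z
              with ~₂-cases a~₂y a~₂c y≢c (dist2 (~-≁⇒≢ y~z (~₂⇒≁ y~₂a)) a≁z a~p p~z)
            ...   | inj₁ refl = contradiction y~z ~-irrefl
            ...   | inj₂ refl = contradiction (~-sym y~z) (nbr≁y x~c)
            y-nbr≡p {z} y~z | no z≢p | no a≁z | no p≁z
              with ~₂-cases p~₂x p~₂b (~⇒≢ x~b) (dist2 z≢p p≁z p~y y~z)
            ...   | inj₁ refl = contradiction (~-sym y~z) (far-≁ far-y)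
            ...   | inj₂ refl = contradiction (~-sym y~z) (nbr≁y x~b)

            p~M : p ~ M
            p~M = through-p y~₂M
              where
              through-p : y ~₂ M → p ~ M
              through-p (dist2 _ _ y~u u~M) with y-nbr≡p y~u
              ... | refl = u~M

            ¬a~₂M : ¬ a ~₂ M
            ¬a~₂M a~₂M with ~₂-cases a~₂y a~₂c y≢c a~₂M
            ... | inj₁ refl = ~₂⇒≢ y~₂M refl
            ... | inj₂ refl = p≁c p~M

            x~M : x ~ M
            x~M with x ~? M | a ~? M
            ... | yes x~M | _ = x~M
            ... | no x≁M  | no a≁M = ⊥-elim (¬a~₂M (dist2 (a≢M ∘ sym) a≁M a~p p~M))
            ... | no x≁M  | yes a~M
              with ~₂-cases x~₂p x~₂t p≢t (dist2 (~-≁⇒≢ p~M (~₂⇒≁ p~₂x)) x≁M x~a a~M)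
            ...   | inj₁ refl = contradiction p~M ~-irrefl
            ...   | inj₂ refl = contradiction a~M (far-≁ far-t)

            a~M : a ~ M
            a~M with a ~? M
            ... | yes a~M = a~M
            ... | no a≁M  = ⊥-elim (¬a~₂M (dist2 (a≢M ∘ sym) a≁M (~-sym x~a) x~M))

            c≁M : c ≁ M
            c≁M c~M with ~₂-cases p~₂x p~₂b (~⇒≢ x~b) (dist2 (nbr≢p x~c) p≁c p~M (~-sym c~M))
            ... | inj₁ refl = ~-irrefl x~c
            ... | inj₂ refl = a≁c a~b

            c~₂M : c ~₂ M
            c~₂M = dist2 (~-≁⇒≢ p~M p≁c) c≁M (~-sym x~c) x~M

            S : List (Fin n)
            S = x ∷ a ∷ b ∷ c ∷ M ∷ p ∷ y ∷ t ∷ []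

            x∈ : x ∈ S
            x∈ = here refl
            a∈ : a ∈ S
            a∈ = there (here refl)
            b∈ : b ∈ S
            b∈ = there (there (here refl))
            c∈ : c ∈ S
            c∈ = there (there (there (here refl)))
            M∈ : M ∈ S
            M∈ = there (there (there (there (here refl))))
            p∈ : p ∈ S
            p∈ = there (there (there (there (there (here refl)))))
            y∈ : y ∈ S
            y∈ = there (there (there (there (there (there (here refl))))))
            t∈ : t ∈ S
            t∈ = there (there (there (there (there (there (there (here refl)))))))

            N-y : ∀ {z} → y ~ z → z ∈ S
            N-y y~z = subst (_∈ S) (sym (y-nbr≡p y~z)) p∈

            N-p : ∀ {z} → p ~ z → z ∈ S
            N-p p~z = ∈-by-two-steps (~-sym p~y) p~z y∈ N-y (∈-by-~₂ y~₂a y~₂M a≢M a∈ M∈)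

            N-a : ∀ {z} → a ~ z → z ∈ S
            N-a a~z = ∈-by-two-steps (~-sym a~p) a~z p∈ N-p (∈-by-~₂ p~₂x p~₂b (~⇒≢ x~b) x∈ b∈)

            N-M : ∀ {z} → M ~ z → z ∈ S
            N-M M~z = ∈-by-two-steps p~M M~z p∈ N-p (∈-by-~₂ p~₂x p~₂b (~⇒≢ x~b) x∈ b∈)

            N-b : ∀ {z} → b ~ z → z ∈ S
            N-b b~z = ∈-by-two-steps a~b b~z a∈ N-a (∈-by-~₂ a~₂y a~₂c y≢c y∈ c∈)

            N-x : ∀ {z} → x ~ z → z ∈ S
            N-x x~z = ∈-by-two-steps (~-sym x~a) x~z a∈ a-nbr (∈-by-~₂ a~₂y a~₂c y≢c y∈ c∈)
              where
              a-nbr : _ → _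
              a-nbr a~z with p ~? _
              ... | yes p~z = ∈-by-~₂ y~₂a y~₂M a≢M a∈ M∈ (y~₂nbr x~z p~z)
              ... | no p≁z  = ∈-by-~₂ p~₂x p~₂b (~⇒≢ x~b) x∈ b∈ (p~₂nbr x~z a~z p≁z)

            N-c : ∀ {z} → c ~ z → z ∈ S
            N-c c~z = ∈-by-two-steps x~c c~z x∈ N-x (∈-by-~₂ x~₂p x~₂t p≢t p∈ t∈)

            N-t : ∀ {z} → t ~ z → z ∈ S
            N-t t~z = ∈-by-two-steps c~t t~z c∈ N-c (∈-by-~₂ c~₂a c~₂M a≢M a∈ M∈)

            absurd : ⊥
            absurd = ¬closed-≤8 connected 9≤n (N-x ∷ N-a ∷ N-b ∷ N-c ∷ N-M ∷ N-p ∷ N-y ∷ N-t ∷ []) x∈ ≤-refl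

          module Via-c-with-p~c {t} (p~c : p ~ c) (c~t : c ~ t) (far-t : Far a t) where

            c~₂y : c ~₂ y
            c~₂y = dist2 y≢c (nbr≁y x~c) (~-sym p~c) p~y

            beyond : ∀ {u v t′} → Geodesic c u v t′ → ⊥
            beyond g′@(geodesic _ _ v~t′ far-t′) with ~₂-cases c~₂y c~₂a (~₂⇒≢ a~₂y) (geodesic⇒~₂ g′)
            ... | inj₁ refl
              with ~₂-cases p~₂x p~₂b (~⇒≢ x~b)
                     (dist2 (~-≁⇒≢ (~-sym p~c) (far-≁ far-t′) ∘ sym) (far-≁-nbr far-t′ (~-sym p~c)) p~y v~t′)
            ...   | inj₁ refl = far-≁ far-t′ (~-sym x~c)
            ...   | inj₂ refl = far-≁-nbr far-t′ (~-sym x~c) x~b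
            beyond (geodesic _ _ v~t′ far-t′) | inj₂ refl =
              ¬three-~₂ x~₂p (x~₂-beyond-c c~t far-t) x~₂t′
                (~-≁⇒≢ a~p (far-≁ far-t)) (~-≁⇒≢ (~-sym p~c) (far-≁ far-t′)) (λ { refl → far-≁ far-t v~t′ })
              where
              x~₂t′ : x ~₂ _
              x~₂t′ = dist2 (~-≁⇒≢ (~-sym x~c) (far-≁ far-t′) ∘ sym) (far-≁-nbr far-t′ (~-sym x~c)) x~a v~t′

            absurd : ⊥
            absurd = beyond (proj₂ (proj₂ (proj₂ (geodesic-from c))))

          absurd : ⊥
          absurd with geodesic-from a
          ... | _ , _ , _ , g′@(geodesic _ _ v~t far-t) with ~₂-cases a~₂y a~₂c y≢c (geodesic⇒~₂ g′)
          ...   | inj₁ refl = ¬far-from-a-near-p x~b a~b p~₂b p~y v~t far-t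
          ...   | inj₂ refl with p ~? c | another-~₂ y~₂a
          ...     | yes p~c | _ = Via-c-with-p~c.absurd p~c v~t far-t
          ...     | no p≁c  | _ , y~₂M , a≢M = Via-c-with-p≁c.absurd p≁c v~t far-t y~₂M a≢M

        ¬nbrs-∉Nₐ-and-∈Nₐ∖Nₚ : ∀ {b c} → x ~ b → x ~ c → c ≢ a → a ≁ c → a ~ b → p ≁ b → ⊥
        ¬nbrs-∉Nₐ-and-∈Nₐ∖Nₚ = OutsideNₐ-InNₐ∖Nₚ.absurd

        module InNₐ∖Nₚ-InNₐ∩Nₚ {b M} (x~b : x ~ b) (a~b : a ~ b) (p≁b : p ≁ b)
                                  (x~M : x ~ M) (a~M : a ~ M) (p~M : p ~ M) where

          p~₂b : p ~₂ b
          p~₂b = p~₂nbr x~b a~b p≁b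

          y~₂M : y ~₂ M
          y~₂M = y~₂nbr x~M p~M

          a≢M : a ≢ M
          a≢M = ~⇒≢ a~M

          nbr~a : ∀ {z} → x ~ z → z ≢ a → a ~ z
          nbr~a {z} x~z z≢a with a ~? z
          ... | yes a~z = a~z
          ... | no a≁z  = ⊥-elim (¬nbrs-∉Nₐ-and-∈Nₐ∖Nₚ x~b x~z z≢a a≁z a~b p≁b)

          module Via-v {v t} (a~₂v : a ~₂ v) (v~t : v ~ t) (far-t : Far a t) where

            v≢x : v ≢ x
            v≢x = ~-≁⇒≢ (~-sym x~a) (~₂⇒≁ a~₂v) ∘ sym

            v≢p : v ≢ p
            v≢p = ~-≁⇒≢ a~p (~₂⇒≁ a~₂v) ∘ sym

            x≁v : x ≁ v
            x≁v x~v = ~₂⇒≁ a~₂v (nbr~a x~v (~₂⇒≢ a~₂v))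

            p≁v : p ≁ v
            p≁v p~v = ¬far-from-a-near-p x~b a~b p~₂b p~v v~t far-t

            M≁v : M ≁ v
            M≁v M~v with ~₂-cases p~₂x p~₂b (~⇒≢ x~b) (dist2 v≢p p≁v p~M M~v)
            ... | inj₁ refl = v≢x refl
            ... | inj₂ refl = ~₂⇒≁ a~₂v a~b

            common-nbr-with-x : ∃[ w ] (x ~ w × w ~ v)
            common-nbr-with-x = via-a a~₂v
              where
              via-a : a ~₂ v → ∃[ w ] (x ~ w × w ~ v)
              via-a (dist2 {u} _ _ a~u u~v) with p ~? u
              ... | yes p~u with ~₂-cases p~₂x p~₂b (~⇒≢ x~b) (dist2 v≢p p≁v p~u u~v)
              ...   | inj₁ refl = contradiction refl v≢x
              ...   | inj₂ refl = contradiction a~b (~₂⇒≁ a~₂v)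
              via-a (dist2 {u} _ _ a~u u~v) | no p≁u
                with ~₂-cases p~₂x p~₂b (~⇒≢ x~b) (dist2 (λ { refl → p≁v u~v }) p≁u (~-sym a~p) a~u)
              ...   | inj₁ refl = contradiction u~v x≁v
              ...   | inj₂ refl = b , x~b , u~v

            absurd : ⊥
            absurd with common-nbr-with-x
            ... | w , x~w , w~v with p ~? w
            ...   | yes p~w with ~₂-cases y~₂a y~₂M a≢M (y~₂nbr x~w p~w)
            ...     | inj₁ refl = ~₂⇒≁ a~₂v w~v
            ...     | inj₂ refl = M≁v w~v
            absurd | w , x~w , w~v | no p≁w
              with ~₂-cases p~₂x p~₂b (~⇒≢ x~b) (p~₂nbr x~w (nbr~a x~w (λ { refl → ~₂⇒≁ a~₂v w~v })) p≁w)
            ...     | inj₁ refl = ~-irrefl x~w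
            ...     | inj₂ refl with b ~? M
            ...       | no b≁M =
              ¬three-~₂ (dist2 (~-≁⇒≢ a~b (far-≁ far-t) ∘ sym) (far-≁-nbr far-t a~b) w~v v~t)
                        (~₂-sym p~₂b) (dist2 (~-≁⇒≢ p~M p≁b) b≁M (~-sym x~b) x~M)
                        (~-≁⇒≢ a~p (far-≁ far-t) ∘ sym) (~-≁⇒≢ a~M (far-≁ far-t) ∘ sym) (~⇒≢ p~M)
            ...       | yes b~M =
              ¬three-~₂ (dist2 (v≢x ∘ sym) (≁-sym x≁v) (~-sym w~v) (~-sym x~b)) (~₂-sym a~₂v)
                        (dist2 (~-≁⇒≢ a~M (~₂⇒≁ a~₂v)) (≁-sym M≁v) (~-sym w~v) b~M)
                        (~⇒≢ x~a) (~⇒≢ x~M) a≢M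

          absurd : ⊥
          absurd with geodesic-from a
          ... | _ , _ , _ , g′@(geodesic _ _ v~t far-t) = Via-v.absurd (geodesic⇒~₂ g′) v~t far-t

        ¬nbrs-∈Nₐ∖Nₚ-and-∈Nₐ∩Nₚ : ∀ {b M} → x ~ b → a ~ b → p ≁ b → x ~ M → a ~ M → p ~ M → ⊥
        ¬nbrs-∈Nₐ∖Nₚ-and-∈Nₐ∩Nₚ = InNₐ∖Nₚ-InNₐ∩Nₚ.absurd

      module BesidesA {x a p y} (g : Geodesic x a p y) where
        open Geodesic g
        open Around g

        module OutsideNₐ-InNₐ∩Nₚ {c M} (x~c : x ~ c) (c≢a : c ≢ a) (a≁c : a ≁ c)
                                  (x~M : x ~ M) (a~M : a ~ M) (p~M : p ~ M) where

          y~₂M : y ~₂ M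
          y~₂M = y~₂nbr x~M p~M

          a≢M : a ≢ M
          a≢M = ~⇒≢ a~M

          y≢c : y ≢ c
          y≢c = nbr≢y x~c ∘ sym

          M≢c : M ≢ c
          M≢c refl = a≁c a~M

          a~₂c : a ~₂ c
          a~₂c = a~₂nbr x~c c≢a a≁c

          p≁c : p ≁ c
          p≁c p~c = ¬three-~₂ y~₂a y~₂M (y~₂nbr x~c p~c) a≢M (c≢a ∘ sym) M≢c

          c≁M : c ≁ M
          c≁M c~M = Around.¬nbrs-∈Nₐ∖Nₚ-and-∈Nₐ∩Nₚ (geodesic x~M (~-sym p~M) p~y far-y)
                      x~c (~-sym c~M) p≁c x~a (~-sym a~M) (~-sym a~p)

          c~₂a : c ~₂ a
          c~₂a = ~₂-sym a~₂c

          c~₂M : c ~₂ M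
          c~₂M = dist2 M≢c c≁M (~-sym x~c) x~M

          x-nbr : ∀ {z} → x ~ z → z ≡ a ⊎ z ≡ c ⊎ z ≡ M
          x-nbr {z} x~z with z ≟ a | a ~? z | p ~? z
          ... | yes z≡a | _       | _ = inj₁ z≡a
          ... | no z≢a  | no a≁z  | _ with ~₂-cases a~₂y a~₂c y≢c (a~₂nbr x~z z≢a a≁z)
          ...   | inj₁ z≡y = contradiction z≡y (nbr≢y x~z)
          ...   | inj₂ z≡c = inj₂ (inj₁ z≡c)
          x-nbr {z} x~z | no z≢a | yes a~z | no p≁z =
            ⊥-elim (¬nbrs-∉Nₐ-and-∈Nₐ∖Nₚ x~z x~c c≢a a≁c a~z p≁z)
          x-nbr {z} x~z | no z≢a | yes a~z | yes p~z with ~₂-cases y~₂a y~₂M a≢M (y~₂nbr x~z p~z)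
          ...   | inj₁ z≡a = contradiction z≡a z≢a
          ...   | inj₂ z≡M = inj₂ (inj₂ z≡M)

          module Via-c {t m′} (c~t : c ~ t) (far-t : Far a t) (p~₂m′ : p ~₂ m′) (x≢m′ : x ≢ m′) where

            x~₂t : x ~₂ t
            x~₂t = dist2 (λ { refl → far-≁ far-t (~-sym x~a) }) (far-≁-nbr far-t (~-sym x~a)) x~c c~t

            p≢t : p ≢ t
            p≢t = ~-≁⇒≢ a~p (far-≁ far-t)

            a-nbr : ∀ {z} → a ~ z → z ≡ x ⊎ z ≡ M ⊎ z ≡ p
            a-nbr {z} a~z with x ~? z | z ≟ x
            ... | yes x~z | _ with x-nbr x~z
            ...   | inj₁ refl        = contradiction a~z ~-irrefl
            ...   | inj₂ (inj₁ refl) = contradiction a~z a≁c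
            ...   | inj₂ (inj₂ z≡M)  = inj₂ (inj₁ z≡M)
            a-nbr {z} a~z | no _ | yes z≡x = inj₁ z≡x
            a-nbr {z} a~z | no x≁z | no z≢x with ~₂-cases x~₂p x~₂t p≢t (dist2 z≢x x≁z x~a a~z)
            ...   | inj₁ z≡p = inj₂ (inj₂ z≡p)
            ...   | inj₂ refl = contradiction a~z (far-≁ far-t)

            M-nbr : ∀ {z} → M ~ z → z ≡ x ⊎ z ≡ a ⊎ z ≡ p
            M-nbr {z} M~z with x ~? z | z ≟ x
            ... | yes x~z | _ with x-nbr x~z
            ...   | inj₁ z≡a         = inj₂ (inj₁ z≡a)
            ...   | inj₂ (inj₁ refl) = contradiction (~-sym M~z) c≁M
            ...   | inj₂ (inj₂ refl) = contradiction M~z ~-irrefl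
            M-nbr {z} M~z | no _ | yes z≡x = inj₁ z≡x
            M-nbr {z} M~z | no x≁z | no z≢x with ~₂-cases x~₂p x~₂t p≢t (dist2 z≢x x≁z x~M M~z)
            ...   | inj₁ z≡p = inj₂ (inj₂ z≡p)
            ...   | inj₂ refl = contradiction M~z (far-≁-nbr far-t a~M)

            p-nbr : ∀ {z} → p ~ z → z ≡ a ⊎ z ≡ M ⊎ z ≡ y
            p-nbr {z} p~z with z ≟ a | x ~? z | a ~? z
            ... | yes z≡a | _       | _ = inj₁ z≡a
            ... | no z≢a  | yes x~z | _ with x-nbr x~z
            ...   | inj₁ z≡a         = contradiction z≡a z≢a
            ...   | inj₂ (inj₁ refl) = contradiction p~z p≁c
            ...   | inj₂ (inj₂ z≡M)  = inj₂ (inj₁ z≡M)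
            p-nbr {z} p~z | no z≢a | no x≁z | yes a~z with a-nbr a~z
            ...   | inj₁ refl        = contradiction p~z (~₂⇒≁ p~₂x)
            ...   | inj₂ (inj₁ z≡M)  = inj₂ (inj₁ z≡M)
            ...   | inj₂ (inj₂ refl) = contradiction p~z ~-irrefl
            p-nbr {z} p~z | no z≢a | no x≁z | no a≁z with ~₂-cases a~₂y a~₂c y≢c (dist2 z≢a a≁z a~p p~z)
            ...   | inj₁ z≡y = inj₂ (inj₂ z≡y)
            ...   | inj₂ refl = contradiction p~z p≁c

            a≁m′ : a ≁ m′
            a≁m′ a~m′ with a-nbr a~m′
            ... | inj₁ refl        = x≢m′ refl
            ... | inj₂ (inj₁ refl) = ~₂⇒≁ p~₂m′ p~M
            ... | inj₂ (inj₂ refl) = ~₂⇒≢ p~₂m′ refl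

            M≁m′ : M ≁ m′
            M≁m′ M~m′ with M-nbr M~m′
            ... | inj₁ refl        = x≢m′ refl
            ... | inj₂ (inj₁ refl) = ~₂⇒≁ p~₂m′ (~-sym a~p)
            ... | inj₂ (inj₂ refl) = ~₂⇒≢ p~₂m′ refl

            y~m′ : y ~ m′
            y~m′ = via-p p~₂m′
              where
              via-p : p ~₂ m′ → y ~ m′
              via-p (dist2 _ _ p~u u~m′) with p-nbr p~u
              ... | inj₁ refl        = contradiction u~m′ a≁m′
              ... | inj₂ (inj₁ refl) = contradiction u~m′ M≁m′
              ... | inj₂ (inj₂ refl) = u~m′

            y-nbr : ∀ {z} → y ~ z → z ≡ p ⊎ z ≡ m′
            y-nbr {z} y~z with z ≟ p | p ~? z
            ... | yes z≡p | _ = inj₁ z≡p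
            ... | no z≢p  | no p≁z with ~₂-cases p~₂x p~₂m′ x≢m′ (dist2 z≢p p≁z p~y y~z)
            ...   | inj₁ refl = contradiction (~-sym y~z) (far-≁ far-y)
            ...   | inj₂ z≡m′ = inj₂ z≡m′
            y-nbr {z} y~z | no z≢p | yes p~z with p-nbr p~z
            ...   | inj₁ refl        = contradiction y~z (~₂⇒≁ y~₂a)
            ...   | inj₂ (inj₁ refl) = contradiction y~z (~₂⇒≁ y~₂M)
            ...   | inj₂ (inj₂ refl) = contradiction y~z ~-irrefl

            m′-nbr≡y : ∀ {z} → m′ ~ z → z ≡ y
            m′-nbr≡y {z} m′~z with z ≟ y | y ~? z
            ... | yes z≡y | _ = z≡y
            ... | no z≢y  | yes y~z with y-nbr y~z
            ...   | inj₁ refl = contradiction (~-sym m′~z) (~₂⇒≁ p~₂m′)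
            ...   | inj₂ refl = contradiction m′~z ~-irrefl
            m′-nbr≡y {z} m′~z | no z≢y | no y≁z with ~₂-cases y~₂a y~₂M a≢M (dist2 z≢y y≁z y~m′ m′~z)
            ...   | inj₁ refl = contradiction (~-sym m′~z) a≁m′
            ...   | inj₂ refl = contradiction (~-sym m′~z) M≁m′

            m′-metamour≡p : ∀ {w} → m′ ~₂ w → w ≡ p
            m′-metamour≡p (dist2 w≢m′ _ m′~u u~w) with m′-nbr≡y m′~u
            ... | refl with y-nbr u~w
            ...   | inj₁ w≡p  = w≡p
            ...   | inj₂ w≡m′ = contradiction w≡m′ w≢m′

            absurd : ⊥
            absurd = fst≢snd (trans (m′-metamour≡p P-fst) (sym (m′-metamour≡p P-snd)))
              where open ExactlyTwo (metamours m′)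

          module Via-y {t q} (y~t : y ~ t) (far-t : Far a t) (x~₂q : x ~₂ q) (p≢q : p ≢ q) where

            x≢t : x ≢ t
            x≢t = ~-≁⇒≢ (~-sym x~a) (far-≁ far-t)

            p~₂t : p ~₂ t
            p~₂t = dist2 (~-≁⇒≢ a~p (far-≁ far-t) ∘ sym) (far-≁-nbr far-t a~p) p~y y~t

            S : List (Fin n)
            S = x ∷ a ∷ M ∷ c ∷ p ∷ q ∷ y ∷ t ∷ []

            x∈ : x ∈ S
            x∈ = here refl
            a∈ : a ∈ S
            a∈ = there (here refl)
            M∈ : M ∈ S
            M∈ = there (there (here refl))
            c∈ : c ∈ S
            c∈ = there (there (there (here refl)))
            p∈ : p ∈ S
            p∈ = there (there (there (there (here refl))))
            q∈ : q ∈ S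
            q∈ = there (there (there (there (there (here refl)))))
            y∈ : y ∈ S
            y∈ = there (there (there (there (there (there (here refl))))))
            t∈ : t ∈ S
            t∈ = there (there (there (there (there (there (there (here refl)))))))

            N-x : ∀ {z} → x ~ z → z ∈ S
            N-x x~z with x-nbr x~z
            ... | inj₁ refl        = a∈
            ... | inj₂ (inj₁ refl) = c∈
            ... | inj₂ (inj₂ refl) = M∈

            N-x-nbr : ∀ {w} → x ~ w → ∀ {z} → w ~ z → z ∈ S
            N-x-nbr x~w w~z = ∈-by-two-steps x~w w~z x∈ N-x (∈-by-~₂ x~₂p x~₂q p≢q p∈ q∈)

            N-p : ∀ {z} → p ~ z → z ∈ S
            N-p p~z = ∈-by-two-steps a~p p~z a∈ (N-x-nbr x~a) (∈-by-~₂ a~₂y a~₂c y≢c y∈ c∈)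

            N-y : ∀ {z} → y ~ z → z ∈ S
            N-y y~z = ∈-by-two-steps p~y y~z p∈ N-p (∈-by-~₂ p~₂x p~₂t x≢t x∈ t∈)

            N-t : ∀ {z} → t ~ z → z ∈ S
            N-t t~z = ∈-by-two-steps y~t t~z y∈ N-y (∈-by-~₂ y~₂a y~₂M a≢M a∈ M∈)

            N-q : ∀ {z} → q ~ z → z ∈ S
            N-q with p ~? q
            ... | yes p~q = λ q~z → ∈-by-two-steps p~q q~z p∈ N-p (∈-by-~₂ p~₂x p~₂t x≢t x∈ t∈)
            ... | no p≁q  = via-middle x~₂q
              where
              via-middle : x ~₂ q → ∀ {z} → q ~ z → z ∈ S
              via-middle (dist2 _ _ x~w w~q) with x-nbr x~w
              ... | inj₂ (inj₁ refl) = λ q~z → ∈-by-two-steps w~q q~z c∈ (N-x-nbr x~c) (∈-by-~₂ c~₂a c~₂M a≢M a∈ M∈)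
              ... | inj₁ refl with ~₂-cases p~₂x p~₂t x≢t (dist2 (p≢q ∘ sym) p≁q (~-sym a~p) w~q)
              ...   | inj₁ refl = ⊥-elim (~₂⇒≢ x~₂q refl)
              ...   | inj₂ refl = ⊥-elim (far-≁ far-t w~q)
              via-middle (dist2 _ _ x~w w~q) | inj₂ (inj₂ refl)
                with ~₂-cases p~₂x p~₂t x≢t (dist2 (p≢q ∘ sym) p≁q p~M w~q)
              ...   | inj₁ refl = ⊥-elim (~₂⇒≢ x~₂q refl)
              ...   | inj₂ refl = ⊥-elim (far-≁-nbr far-t a~M w~q)

            absurd : ⊥
            absurd = ¬closed-≤8 connected 9≤n
                       (N-x ∷ N-x-nbr x~a ∷ N-x-nbr x~M ∷ N-x-nbr x~c ∷ N-p ∷ N-q ∷ N-y ∷ N-t ∷ []) x∈ ≤-refl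

          absurd : ⊥
          absurd with geodesic-from a
          ... | _ , _ , _ , g′@(geodesic _ _ v~t far-t) with ~₂-cases a~₂y a~₂c y≢c (geodesic⇒~₂ g′)
          ...   | inj₁ refl with another-~₂ x~₂p
          ...     | _ , x~₂q , p≢q = Via-y.absurd v~t far-t x~₂q p≢q
          absurd | _ , _ , _ , geodesic _ _ v~t far-t | inj₂ refl with another-~₂ p~₂x
          ...     | _ , p~₂m′ , x≢m′ = Via-c.absurd v~t far-t p~₂m′ x≢m′

        ¬nbrs-∉Nₐ-and-∈Nₐ∩Nₚ : ∀ {c M} → x ~ c → c ≢ a → a ≁ c → x ~ M → a ~ M → p ~ M → ⊥
        ¬nbrs-∉Nₐ-and-∈Nₐ∩Nₚ = OutsideNₐ-InNₐ∩Nₚ.absurd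

        ¬two-nbrs-besides-a : ∀ {b c} → x ~ b → x ~ c → b ≢ a → c ≢ a → b ≢ c → ⊥
        ¬two-nbrs-besides-a {b} {c} x~b x~c b≢a c≢a b≢c with a ~? b | a ~? c | p ~? b | p ~? c
        ... | no a≁b  | no a≁c  | _       | _       =
          ¬three-~₂ a~₂y (a~₂nbr x~b b≢a a≁b) (a~₂nbr x~c c≢a a≁c) (nbr≢y x~b ∘ sym) (nbr≢y x~c ∘ sym) b≢c
        ... | no a≁b  | yes a~c | _       | no p≁c  = ¬nbrs-∉Nₐ-and-∈Nₐ∖Nₚ x~c x~b b≢a a≁b a~c p≁c
        ... | no a≁b  | yes a~c | _       | yes p~c = ¬nbrs-∉Nₐ-and-∈Nₐ∩Nₚ x~b b≢a a≁b x~c a~c p~c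
        ... | yes a~b | no a≁c  | no p≁b  | _       = ¬nbrs-∉Nₐ-and-∈Nₐ∖Nₚ x~b x~c c≢a a≁c a~b p≁b
        ... | yes a~b | no a≁c  | yes p~b | _       = ¬nbrs-∉Nₐ-and-∈Nₐ∩Nₚ x~c c≢a a≁c x~b a~b p~b
        ... | yes a~b | yes a~c | no p≁b  | no p≁c  =
          ¬three-~₂ p~₂x (p~₂nbr x~b a~b p≁b) (p~₂nbr x~c a~c p≁c) (~⇒≢ x~b) (~⇒≢ x~c) b≢c
        ... | yes a~b | yes a~c | no p≁b  | yes p~c = ¬nbrs-∈Nₐ∖Nₚ-and-∈Nₐ∩Nₚ x~b a~b p≁b x~c a~c p~c
        ... | yes a~b | yes a~c | yes p~b | no p≁c  = ¬nbrs-∈Nₐ∖Nₚ-and-∈Nₐ∩Nₚ x~c a~c p≁c x~b a~b p~b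
        ... | yes a~b | yes a~c | yes p~b | yes p~c =
          ¬three-~₂ y~₂a (y~₂nbr x~b p~b) (y~₂nbr x~c p~c) (b≢a ∘ sym) (c≢a ∘ sym) b≢c

      ¬three-nbrs : ∀ {x z₁ z₂ z₃} → x ~ z₁ → x ~ z₂ → x ~ z₃ → z₁ ≢ z₂ → z₁ ≢ z₃ → z₂ ≢ z₃ → ⊥
      ¬three-nbrs {x} {z₁} {z₂} x~z₁ x~z₂ x~z₃ z₁≢z₂ z₁≢z₃ z₂≢z₃ with geodesic-from x
      ... | a , _ , _ , g with z₁ ≟ a | z₂ ≟ a
      ...   | yes refl | _        = BesidesA.¬two-nbrs-besides-a g x~z₂ x~z₃ (z₁≢z₂ ∘ sym) (z₁≢z₃ ∘ sym) z₂≢z₃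
      ...   | no z₁≢a  | yes refl = BesidesA.¬two-nbrs-besides-a g x~z₁ x~z₃ z₁≢a (z₂≢z₃ ∘ sym) z₁≢z₃
      ...   | no z₁≢a  | no z₂≢a  = BesidesA.¬two-nbrs-besides-a g x~z₁ x~z₂ z₁≢a z₂≢a z₁≢z₂

      two-nbrs : ∀ v → ∃[ u₁ ] ∃[ u₂ ] (v ~ u₁ × v ~ u₂ × u₁ ≢ u₂)
      two-nbrs v with metamours v
      ... | exactlyTwo w₁ w₂ w₁≢w₂ (dist2 {u₁} w₁≢v _ v~u₁ u₁~w₁) (dist2 {u₂} w₂≢v _ v~u₂ u₂~w₂) _ with u₁ ≟ u₂
      ...   | no u₁≢u₂ = u₁ , u₂ , v~u₁ , v~u₂ , u₁≢u₂
      ...   | yes refl = ⊥-elim (¬three-nbrs (~-sym v~u₁) u₁~w₁ u₂~w₂ (w₁≢v ∘ sym) (w₂≢v ∘ sym) w₁≢w₂)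

      neighbours : ∀ v → ExactlyTwo (v ~_)
      neighbours v with two-nbrs v
      ... | u₁ , u₂ , v~u₁ , v~u₂ , u₁≢u₂ = exactlyTwo u₁ u₂ u₁≢u₂ v~u₁ v~u₂ only
        where
        only : ∀ {z} → v ~ z → z ≡ u₁ ⊎ z ≡ u₂
        only {z} v~z with z ≟ u₁ | z ≟ u₂
        ... | yes z≡u₁ | _        = inj₁ z≡u₁
        ... | no _     | yes z≡u₂ = inj₂ z≡u₂
        ... | no z≢u₁  | no z≢u₂  = ⊥-elim (¬three-nbrs v~u₁ v~u₂ v~z u₁≢u₂ (z≢u₁ ∘ sym) (z≢u₂ ∘ sym))

      regular : Regular G 2
      regular v = exactlyTwo⇒length≡2 (Neighbours-unique v) (exactlyTwo-⇔ (⇔-sym ∈-Neighbours) (neighbours v))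

  module CoRegular (9≤n : 9 ≤ n) (regular : Regular G (n ∸ 3)) where

    nonNeighbours≡3 : ∀ v → length (NonNeighbours v) ≡ 3
    nonNeighbours≡3 v = +-cancelˡ-≡ (n ∸ 3) _ 3 (begin
      n ∸ 3 + length (NonNeighbours v)        ≡⟨ cong (_+ length (NonNeighbours v)) (regular v) ⟨
      degree G v + length (NonNeighbours v)   ≡⟨ degree+nonNeighbours≡n v ⟩
      n                                       ≡⟨ m∸n+n≡m (≤-trans (m≤m+n 3 6) 9≤n) ⟨
      n ∸ 3 + 3                               ∎)
      where open ≡-Reasoning

    common-neighbour : ∀ {v w} → v ≁ w → ∃[ u ] (v ~ u × u ~ w)
    common-neighbour {v} {w} v≁w with any? (λ u → (v ~? u) ×-dec (u ~? w))
    ... | yes common = common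
    ... | no ¬common = ⊥-elim (6≰3 (begin
      6                            ≤⟨ ∸-monoˡ-≤ 3 9≤n ⟩
      n ∸ 3                        ≡⟨ regular w ⟨
      length (Neighbours w)        ≤⟨ unique-⊆⇒length≤ (Neighbours-unique w) nbrs⊆ ⟩
      length (NonNeighbours v)     ≡⟨ nonNeighbours≡3 v ⟩
      3                            ∎))
      where
      open ≤-Reasoning
      6≰3 : ¬ 6 ≤ 3
      6≰3 (s≤s (s≤s (s≤s ())))
      nbrs⊆ : Neighbours w ⊆ NonNeighbours v
      nbrs⊆ {z} z∈ = Equivalence.from ∈-NonNeighbours
        (λ v~z → ¬common (z , v~z , ~-sym (Equivalence.to ∈-Neighbours z∈)))

    metamours : ∀ v → ExactlyTwo (v ~₂_)
    metamours v = exactlyTwo-⇔ nonNeighbour⇔~₂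
      (length≡3⇒exactlyTwo-≢ (NonNeighbours-unique v) (nonNeighbours≡3 v)
                              (Equivalence.from ∈-NonNeighbours ~-irrefl))
      where
      nonNeighbour⇔~₂ : ∀ {z} → (z ∈ NonNeighbours v × z ≢ v) ⇔ v ~₂ z
      nonNeighbour⇔~₂ = mk⇔ to (λ v~₂z → Equivalence.from ∈-NonNeighbours (~₂⇒≁ v~₂z) , ~₂⇒≢ v~₂z)
        where
        to : ∀ {z} → z ∈ NonNeighbours v × z ≢ v → v ~₂ z
        to (z∈ , z≢v) with common-neighbour (Equivalence.to ∈-NonNeighbours z∈)
        ... | _ , v~u , u~z = dist2 z≢v (Equivalence.to ∈-NonNeighbours z∈) v~u u~z

  module Cycle (connected : Connected G) (9≤n : 9 ≤ n) (regular : Regular G 2) where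

    neighbours : ∀ u → ExactlyTwo (u ~_)
    neighbours u = exactlyTwo-⇔ ∈-Neighbours (length≡2⇒exactlyTwo (Neighbours-unique u) (regular u))

    no-triangle : ∀ {v a b} → v ~ a → v ~ b → a ≁ b
    no-triangle {v} {a} {b} v~a v~b a~b = ¬closed-≤8 connected 9≤n closed (here refl) (m≤m+n 3 5)
      where
      closed : Closed (v ∷ a ∷ b ∷ [])
      closed = (λ v~z → ∈-from-≡⊎≡ (exactlyTwo-cases (neighbours v) v~a v~b (~⇒≢ a~b) v~z)
                                   (there (here refl)) (there (there (here refl))))
             ∷ (λ a~z → ∈-from-≡⊎≡ (exactlyTwo-cases (neighbours a) (~-sym v~a) a~b (~⇒≢ v~b) a~z)
                                   (here refl) (there (there (here refl))))
             ∷ (λ b~z → ∈-from-≡⊎≡ (exactlyTwo-cases (neighbours b) (~-sym v~b) (~-sym a~b) (~⇒≢ v~a) b~z)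
                                   (here refl) (there (here refl)))
             ∷ []

    no-square : ∀ {v a b c} → v ~ a → v ~ b → a ~ c → b ~ c → a ≢ b → c ≢ v → ⊥
    no-square {v} {a} {b} {c} v~a v~b a~c b~c a≢b c≢v = ¬closed-≤8 connected 9≤n closed (here refl) (m≤m+n 4 4)
      where
      closed : Closed (v ∷ a ∷ b ∷ c ∷ [])
      closed = (λ v~z → ∈-from-≡⊎≡ (exactlyTwo-cases (neighbours v) v~a v~b a≢b v~z)
                                   (there (here refl)) (there (there (here refl))))
             ∷ (λ a~z → ∈-from-≡⊎≡ (exactlyTwo-cases (neighbours a) (~-sym v~a) a~c (c≢v ∘ sym) a~z)
                                   (here refl) (there (there (there (here refl)))))
             ∷ (λ b~z → ∈-from-≡⊎≡ (exactlyTwo-cases (neighbours b) (~-sym v~b) b~c (c≢v ∘ sym) b~z)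
                                   (here refl) (there (there (there (here refl)))))
             ∷ (λ c~z → ∈-from-≡⊎≡ (exactlyTwo-cases (neighbours c) (~-sym a~c) (~-sym b~c) a≢b c~z)
                                   (there (here refl)) (there (there (here refl))))
             ∷ []

    other-neighbour : ∀ {u v} → u ~ v → ∃[ u′ ] (u ~ u′ × u′ ≢ v × (∀ {z} → u ~ z → z ≡ v ⊎ z ≡ u′))
    other-neighbour {u} u~v with exactlyTwo-another (neighbours u) u~v
    ... | u′ , u~u′ , v≢u′ = u′ , u~u′ , v≢u′ ∘ sym , exactlyTwo-cases (neighbours u) u~v u~u′ v≢u′

    metamours : ∀ v → ExactlyTwo (v ~₂_)
    metamours v with neighbours v
    ... | exactlyTwo a b a≢b v~a v~b v-nbr
      with other-neighbour (~-sym v~a) | other-neighbour (~-sym v~b)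
    ...   | a′ , a~a′ , a′≢v , a-nbr | b′ , b~b′ , b′≢v , b-nbr =
      exactlyTwo a′ b′ a′≢b′ (dist2 a′≢v (non-nbr (~⇒≢ a~a′ ∘ sym) a′≢b) v~a a~a′)
                             (dist2 b′≢v (non-nbr b′≢a (~⇒≢ b~b′ ∘ sym)) v~b b~b′) only
      where
      a′≢b : a′ ≢ b
      a′≢b refl = no-triangle v~a v~b a~a′
      b′≢a : b′ ≢ a
      b′≢a refl = no-triangle v~b v~a b~b′
      a′≢b′ : a′ ≢ b′
      a′≢b′ refl = no-square v~a v~b a~a′ b~b′ a≢b a′≢v
      non-nbr : ∀ {w} → w ≢ a → w ≢ b → v ≁ w
      non-nbr w≢a w≢b v~w = [ w≢a , w≢b ] (v-nbr v~w)
      only : ∀ {w} → v ~₂ w → w ≡ a′ ⊎ w ≡ b′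
      only (dist2 w≢v _ v~u u~w) with v-nbr v~u
      only (dist2 w≢v _ v~u u~w) | inj₁ refl with a-nbr u~w
      ...   | inj₁ w≡v  = contradiction w≡v w≢v
      ...   | inj₂ w≡a′ = inj₁ w≡a′
      only (dist2 w≢v _ v~u u~w) | inj₂ refl with b-nbr u~w
      ...   | inj₁ w≡v  = contradiction w≡v w≢v
      ...   | inj₂ w≡b′ = inj₂ w≡b′

corollary3p16 : ∀ (n : ℕ) (G : Graph n) → 9 ≤ n → Connected G →
    (TwoMetamourRegular G ⇔ (Regular G 2 ⊎ Regular G (n ∸ 3)))
corollary3p16 n G 9≤n connected = mk⇔ to from
  where
  to : TwoMetamourRegular G → Regular G 2 ⊎ Regular G (n ∸ 3)
  to tmr with any? (λ x → all? (Near? G x))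
  ... | yes (x , centre) = inj₂ (λ v → degree-centre (centre-everywhere v))
    where
    open MetamourRegular G tmr
    open Centre 9≤n centre
  ... | no ¬centre = inj₁ (MetamourRegular.NoCentre.regular G tmr connected 9≤n far-vertex)
    where
    far-vertex : ∀ v → ∃[ t ] Far G v t
    far-vertex v with ¬∀⟶∃¬ n (Near G v) (Near? G v) (λ centre → ¬centre (v , centre))
    ... | t , ¬near = t , ¬Near⇒Far G ¬near

  from : Regular G 2 ⊎ Regular G (n ∸ 3) → TwoMetamourRegular G
  from (inj₁ 2-regular) =
    Equivalence.from (TwoMetamourRegular⇔exactlyTwo G) (Cycle.metamours G connected 9≤n 2-regular)
  from (inj₂ co-regular) =
    Equivalence.from (TwoMetamourRegular⇔exactlyTwo G) (CoRegular.metamours G 9≤n co-regular)
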